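{- Let $A$ be the adjacency matrix of a simple graph on $n$ vertices and let $B$ be an $n\times n$ integral symmetric matrix. If $A$ and $B$ are generalized cospectral, then $B$ is also an adjacency matrix, i.e., a symmetric $(0,1)$-matrix with zero diagonal.
   Context: $J$ denotes the $n\times n$ all-one matrix and $I$ the identity. Two $n\times n$ matrices $M_1,M_2$ are generalized cospectral if $M_1$ and $M_2$ have the same spectrum and $J-I-M_1$ and $J-I-M_2$ have the same spectrum. -}

module Defs where

open import Data.Nat using (ℕ; zero; suc)
open import Data.Fin using (Fin; zero; suc; punchIn; _≟_)
open import Data.Integer using (ℤ; _+_; _*_; _-_; -_; 0ℤ; 1ℤ)
open import Data.Product using (_×_)
open import Data.Sum using (_⊎_)
open import Relation.Nullary using (yes; no)
open import Relation.Binary.PropositionalEquality using (_≡_)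

Mat : ℕ → Set
Mat n = Fin n → Fin n → ℤ

sumFin : ∀ {n} → (Fin n → ℤ) → ℤ
sumFin {zero}  f = 0ℤ
sumFin {suc n} f = f zero + sumFin (λ i → f (suc i))

sgn : ℕ → ℤ
sgn zero    = 1ℤ
sgn (suc k) = - sgn k

det : ∀ {n} → Mat n → ℤ
det {zero}  M = 1ℤ
det {suc n} M = sumFin (λ j → sgn (Data.Fin.toℕ j) * (M zero j * det (λ i k → M (suc i) (punchIn j k))))

δ : ∀ {n} → Fin n → Fin n → ℤ
δ i j with i ≟ j
... | yes _ = 1ℤ
... | no  _ = 0ℤ

charPoly : ∀ {n} → Mat n → ℤ → ℤ
charPoly M t = det (λ i j → t * δ i j - M i j)

-- Same spectrum (integral matrices): same characteristic polynomial,
-- i.e. det(tI - M₁) = det(tI - M₂) as polynomials; since both are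
-- polynomials, equality at every integer t is equality of polynomials.
Cospectral : ∀ {n} → Mat n → Mat n → Set
Cospectral M₁ M₂ = ∀ t → charPoly M₁ t ≡ charPoly M₂ t

compl : ∀ {n} → Mat n → Mat n
compl M i j = 1ℤ - δ i j - M i j

GenCospectral : ∀ {n} → Mat n → Mat n → Set
GenCospectral M₁ M₂ = Cospectral M₁ M₂ × Cospectral (compl M₁) (compl M₂)

Symmetric : ∀ {n} → Mat n → Set
Symmetric M = ∀ i j → M i j ≡ M j i

IsAdjacency : ∀ {n} → Mat n → Set
IsAdjacency M = Symmetric M × (∀ i → M i i ≡ 0ℤ) × (∀ i j → M i j ≡ 0ℤ ⊎ M i j ≡ 1ℤ)

-- Write C = J - I - M for the complement of an integral symmetric matrix M, and call
-- M i j ² + C i j ² - (1 - δ i j)² the defect of the entry (i , j). Its sum over all entries is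
-- tr M² + tr C² - n (n - 1), and tr M² = (tr M)² - 2 σ₂ M, where tr M and σ₂ M are read off the
-- coefficients of t ^ (n - 1) and t ^ (n - 2) of det (t I - M); so the total defect depends only on
-- the generalized spectrum. For an adjacency matrix every defect is 0. For an integral symmetric B
-- the defect is 2 b² on the diagonal and 2 b (b - 1) off it, hence nonnegative; so all defects of B
-- vanish, which forces b = 0 on the diagonal and b ∈ {0, 1} off it.
-- To get at those coefficients, det (t I - M) is expanded into a coefficient list; two integer
-- polynomials agreeing at every positive integer have the same coefficients, because their
-- constant terms are congruent modulo every modulus.

module Submission where

open import Defs
open import Algebra.Bundles using (AbelianGroup)
open import Data.Bool using (Bool; true; false; not; if_then_else_)
open import Data.Empty using (⊥-elim)
open import Data.Fin using (Fin; zero; suc; punchIn; toℕ; _≟_)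
open import Data.Fin.Properties using (punchInᵢ≢i)
open import Data.Integer using (ℤ; +0; +[1+_]; -[1+_]; _+_; _*_; _-_; -_; 0ℤ; 1ℤ; ∣_∣; _≤_; +≤+)
import Data.Integer.Properties as ℤ
open import Data.Integer.Tactic.RingSolver using (solve-∀; solve)
open import Data.List using (List; []; _∷_; map; drop)
open import Data.Nat as ℕ using (ℕ; zero; suc; s≤s)
import Data.Nat.Properties as ℕ
open import Data.Product using (_×_; _,_; proj₁; proj₂)
open import Data.Sum as Sum using (_⊎_; inj₁; inj₂; [_,_]′)
open import Function using (_∘_; id)
open import Relation.Binary.PropositionalEquality
open import Relation.Nullary using (Dec; yes; no; does)
open import Algebra.Properties.Group (AbelianGroup.group ℤ.+-0-abelianGroup)
  using () renaming (∙-cancelˡ to +-cancelˡ)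

sumFin-cong : ∀ {n} {f g : Fin n → ℤ} → (∀ i → f i ≡ g i) → sumFin f ≡ sumFin g
sumFin-cong {zero}  f≗g = refl
sumFin-cong {suc n} f≗g = cong₂ _+_ (f≗g zero) (sumFin-cong (f≗g ∘ suc))

sumFin-≡0 : ∀ {n} {f : Fin n → ℤ} → (∀ i → f i ≡ 0ℤ) → sumFin f ≡ 0ℤ
sumFin-≡0 {zero}  f≗0 = refl
sumFin-≡0 {suc n} f≗0 = cong₂ _+_ (f≗0 zero) (sumFin-≡0 (f≗0 ∘ suc))

sumFin-+ : ∀ {n} (f g : Fin n → ℤ) → sumFin (λ i → f i + g i) ≡ sumFin f + sumFin g
sumFin-+ {zero}  f g = refl
sumFin-+ {suc n} f g = trans (cong ((f zero + g zero) +_) (sumFin-+ (f ∘ suc) (g ∘ suc)))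
  (algebra (f zero) (g zero) (sumFin (f ∘ suc)) (sumFin (g ∘ suc)))
  where
  algebra : ∀ a b c d → a + b + (c + d) ≡ a + c + (b + d)
  algebra = solve-∀

sumFin-neg : ∀ {n} (f : Fin n → ℤ) → sumFin (λ i → - f i) ≡ - sumFin f
sumFin-neg {zero}  f = refl
sumFin-neg {suc n} f = trans (cong (- f zero +_) (sumFin-neg (f ∘ suc))) (sym (ℤ.neg-distrib-+ (f zero) _))

sumFin-+- : ∀ {n} (f g h : Fin n → ℤ) → sumFin (λ i → f i + g i - h i) ≡ sumFin f + sumFin g - sumFin h
sumFin-+- f g h = trans (sumFin-+ (λ i → f i + g i) (λ i → - h i)) (cong₂ _+_ (sumFin-+ f g) (sumFin-neg h))

-- Integer polynomials

-- Coefficient lists, constant term first.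
Poly : Set
Poly = List ℤ

coeff : Poly → ℕ → ℤ
coeff []      k       = 0ℤ
coeff (a ∷ p) zero    = a
coeff (a ∷ p) (suc k) = coeff p k

eval : Poly → ℤ → ℤ
eval []      t = 0ℤ
eval (a ∷ p) t = a + t * eval p t

infixl 6 _⊕_
_⊕_ : Poly → Poly → Poly
[]      ⊕ q       = q
(a ∷ p) ⊕ []      = a ∷ p
(a ∷ p) ⊕ (b ∷ q) = a + b ∷ p ⊕ q

scale : ℤ → Poly → Poly
scale a = map (a *_)

mulLinear : ℤ × ℤ → Poly → Poly
mulLinear (c , e) p = scale c p ⊕ (0ℤ ∷ scale e p)

sumPoly : ∀ {n} → (Fin n → Poly) → Poly
sumPoly {zero}  f = []
sumPoly {suc n} f = f zero ⊕ sumPoly (f ∘ suc)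

sumPoly-cong : ∀ {n} {f g : Fin n → Poly} → (∀ i → f i ≡ g i) → sumPoly f ≡ sumPoly g
sumPoly-cong {zero}  f≗g = refl
sumPoly-cong {suc n} f≗g = cong₂ _⊕_ (f≗g zero) (sumPoly-cong (f≗g ∘ suc))

coeff-⊕ : ∀ p q k → coeff (p ⊕ q) k ≡ coeff p k + coeff q k
coeff-⊕ []      q       k       = sym (ℤ.+-identityˡ _)
coeff-⊕ (a ∷ p) []      k       = sym (ℤ.+-identityʳ _)
coeff-⊕ (a ∷ p) (b ∷ q) zero    = refl
coeff-⊕ (a ∷ p) (b ∷ q) (suc k) = coeff-⊕ p q k

coeff-scale : ∀ a p k → coeff (scale a p) k ≡ a * coeff p k
coeff-scale a []      k       = sym (ℤ.*-zeroʳ a)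
coeff-scale a (x ∷ p) zero    = refl
coeff-scale a (x ∷ p) (suc k) = coeff-scale a p k

coeff-mulLinear : ∀ c e p k → coeff (mulLinear (c , e) p) (suc k) ≡ c * coeff p (suc k) + e * coeff p k
coeff-mulLinear c e p k = trans (coeff-⊕ (scale c p) (0ℤ ∷ scale e p) (suc k))
  (cong₂ _+_ (coeff-scale c p (suc k)) (coeff-scale e p k))

coeff-mulConstant : ∀ c p k → coeff (mulLinear (c , 0ℤ) p) k ≡ c * coeff p k
coeff-mulConstant c p zero    = trans (coeff-⊕ (scale c p) (0ℤ ∷ scale 0ℤ p) 0)
  (trans (ℤ.+-identityʳ _) (coeff-scale c p 0))
coeff-mulConstant c p (suc k) = trans (coeff-mulLinear c 0ℤ p k)
  (trans (cong (c * coeff p (suc k) +_) (ℤ.*-zeroˡ (coeff p k))) (ℤ.+-identityʳ _))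

coeff-sumPoly : ∀ {n} (f : Fin n → Poly) k → coeff (sumPoly f) k ≡ sumFin (λ j → coeff (f j) k)
coeff-sumPoly {zero}  f k = refl
coeff-sumPoly {suc n} f k =
  trans (coeff-⊕ (f zero) _ k) (cong (coeff (f zero) k +_) (coeff-sumPoly (f ∘ suc) k))

eval-⊕ : ∀ p q t → eval (p ⊕ q) t ≡ eval p t + eval q t
eval-⊕ []      q       t = sym (ℤ.+-identityˡ _)
eval-⊕ (a ∷ p) []      t = sym (ℤ.+-identityʳ _)
eval-⊕ (a ∷ p) (b ∷ q) t = begin
  a + b + t * eval (p ⊕ q) t          ≡⟨ cong (λ z → a + b + t * z) (eval-⊕ p q t) ⟩
  a + b + t * (eval p t + eval q t)   ≡⟨ algebra a b t (eval p t) (eval q t) ⟩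
  a + t * eval p t + (b + t * eval q t) ∎
  where
  open ≡-Reasoning
  algebra : ∀ a b t x y → a + b + t * (x + y) ≡ a + t * x + (b + t * y)
  algebra = solve-∀

eval-scale : ∀ a p t → eval (scale a p) t ≡ a * eval p t
eval-scale a []      t = sym (ℤ.*-zeroʳ a)
eval-scale a (x ∷ p) t = trans (cong (λ z → a * x + t * z) (eval-scale a p t)) (algebra a x t (eval p t))
  where
  algebra : ∀ a x t y → a * x + t * (a * y) ≡ a * (x + t * y)
  algebra = solve-∀

eval-mulLinear : ∀ c e p t → eval (mulLinear (c , e) p) t ≡ (c + t * e) * eval p t
eval-mulLinear c e p t = begin
  eval (scale c p ⊕ (0ℤ ∷ scale e p)) t
    ≡⟨ eval-⊕ (scale c p) (0ℤ ∷ scale e p) t ⟩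
  eval (scale c p) t + (0ℤ + t * eval (scale e p) t)
    ≡⟨ cong₂ (λ u v → u + (0ℤ + t * v)) (eval-scale c p t) (eval-scale e p t) ⟩
  c * eval p t + (0ℤ + t * (e * eval p t))
    ≡⟨ algebra c e t (eval p t) ⟩
  (c + t * e) * eval p t ∎
  where
  open ≡-Reasoning
  algebra : ∀ c e t x → c * x + (0ℤ + t * (e * x)) ≡ (c + t * e) * x
  algebra = solve-∀

eval-sumPoly : ∀ {n} (f : Fin n → Poly) t → eval (sumPoly f) t ≡ sumFin (λ j → eval (f j) t)
eval-sumPoly {zero}  f t = refl
eval-sumPoly {suc n} f t =
  trans (eval-⊕ (f zero) _ t) (cong (eval (f zero) t +_) (eval-sumPoly (f ∘ suc) t))

eval-drop1 : ∀ p t → eval p t ≡ coeff p 0 + t * eval (drop 1 p) t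
eval-drop1 []      t = solve (t ∷ [])
eval-drop1 (a ∷ p) t = refl

coeff-drop1 : ∀ p k → coeff p (suc k) ≡ coeff (drop 1 p) k
coeff-drop1 []      k = refl
coeff-drop1 (a ∷ p) k = refl

m≡[1+m]*k⇒m≡0 : ∀ m k → m ≡ suc m ℕ.* k → m ≡ 0
m≡[1+m]*k⇒m≡0 m zero    eq = trans eq (ℕ.*-zeroʳ m)
m≡[1+m]*k⇒m≡0 m (suc k) eq =
  ⊥-elim (ℕ.<-irrefl eq (ℕ.m≤m*n (suc m) (suc k)))

a+sx≡b+sy⇒a-b≡s[y-x] : ∀ a b s x y → a + s * x ≡ b + s * y → a - b ≡ s * (y - x)
a+sx≡b+sy⇒a-b≡s[y-x] a b s x y eq = begin
  a - b                   ≡⟨ solve (a ∷ b ∷ s ∷ x ∷ []) ⟩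
  a + s * x - b - s * x   ≡⟨ cong (λ z → z - b - s * x) eq ⟩
  b + s * y - b - s * x   ≡⟨ solve (b ∷ s ∷ x ∷ y ∷ []) ⟩
  s * (y - x)             ∎
  where open ≡-Reasoning

congruent-mod-all⇒≡ : ∀ a b (x y : ℕ → ℤ) →
  (∀ m → a + +[1+ m ] * x m ≡ b + +[1+ m ] * y m) → a ≡ b
congruent-mod-all⇒≡ a b x y congruent = ℤ.i-j≡0⇒i≡j a b (ℤ.∣i∣≡0⇒i≡0 ∣a-b∣≡0)
  where
  -- the modulus 1 + ∣ a - b ∣ divides a - b but exceeds it in absolute value
  m = ∣ a - b ∣
  ∣a-b∣≡0 : m ≡ 0
  ∣a-b∣≡0 = m≡[1+m]*k⇒m≡0 m ∣ y m - x m ∣ (begin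
    m                               ≡⟨ cong ∣_∣ (a+sx≡b+sy⇒a-b≡s[y-x] a b +[1+ m ] (x m) (y m) (congruent m)) ⟩
    ∣ +[1+ m ] * (y m - x m) ∣      ≡⟨ ℤ.abs-* +[1+ m ] (y m - x m) ⟩
    suc m ℕ.* ∣ y m - x m ∣         ∎)
    where open ≡-Reasoning

eval≗⇒coeff≡ : ∀ p q → (∀ m → eval p +[1+ m ] ≡ eval q +[1+ m ]) → ∀ k → coeff p k ≡ coeff q k
eval≗⇒coeff≡ p q p≗q zero = congruent-mod-all⇒≡ (coeff p 0) (coeff q 0)
  (λ m → eval (drop 1 p) +[1+ m ]) (λ m → eval (drop 1 q) +[1+ m ])
  (λ m → trans (sym (eval-drop1 p +[1+ m ])) (trans (p≗q m) (eval-drop1 q +[1+ m ])))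
eval≗⇒coeff≡ p q p≗q (suc k) = begin
  coeff p (suc k)         ≡⟨ coeff-drop1 p k ⟩
  coeff (drop 1 p) k      ≡⟨ eval≗⇒coeff≡ (drop 1 p) (drop 1 q) tails≗ k ⟩
  coeff (drop 1 q) k      ≡⟨ coeff-drop1 q k ⟨
  coeff q (suc k)         ∎
  where
  open ≡-Reasoning
  tails≗ : ∀ m → eval (drop 1 p) +[1+ m ] ≡ eval (drop 1 q) +[1+ m ]
  tails≗ m = ℤ.*-cancelˡ-≡ +[1+ m ] _ _ (+-cancelˡ (coeff q 0) _ _ (begin
    coeff q 0 + +[1+ m ] * eval (drop 1 p) +[1+ m ]
      ≡⟨ cong (_+ _) (eval≗⇒coeff≡ p q p≗q 0) ⟨
    coeff p 0 + +[1+ m ] * eval (drop 1 p) +[1+ m ]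
      ≡⟨ trans (sym (eval-drop1 p +[1+ m ])) (trans (p≗q m) (eval-drop1 q +[1+ m ])) ⟩
    coeff q 0 + +[1+ m ] * eval (drop 1 q) +[1+ m ] ∎))

-- The coefficient of t ^ k in t² · p; the shift lets us name the coefficients of t ^ (n ∸ 1)
-- and t ^ (n ∸ 2) of a polynomial of degree n without truncated subtraction.
coeff₂ : Poly → ℕ → ℤ
coeff₂ p = coeff (0ℤ ∷ 0ℤ ∷ p)

coeff₂-⊕ : ∀ p q k → coeff₂ (p ⊕ q) k ≡ coeff₂ p k + coeff₂ q k
coeff₂-⊕ p q zero          = refl
coeff₂-⊕ p q (suc zero)    = refl
coeff₂-⊕ p q (suc (suc k)) = coeff-⊕ p q k

coeff₂-scale : ∀ a p k → coeff₂ (scale a p) k ≡ a * coeff₂ p k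
coeff₂-scale a p zero          = sym (ℤ.*-zeroʳ a)
coeff₂-scale a p (suc zero)    = sym (ℤ.*-zeroʳ a)
coeff₂-scale a p (suc (suc k)) = coeff-scale a p k

coeff₂-mulLinear : ∀ c e p k → coeff₂ (mulLinear (c , e) p) (suc k) ≡ c * coeff₂ p (suc k) + e * coeff₂ p k
coeff₂-mulLinear c e p zero = solve (c ∷ e ∷ [])
coeff₂-mulLinear c e p (suc zero) = begin
  coeff (scale c p ⊕ (0ℤ ∷ scale e p)) 0   ≡⟨ coeff-⊕ (scale c p) (0ℤ ∷ scale e p) 0 ⟩
  coeff (scale c p) 0 + 0ℤ                 ≡⟨ cong (_+ 0ℤ) (coeff-scale c p 0) ⟩
  c * coeff p 0 + 0ℤ                       ≡⟨ cong (c * coeff p 0 +_) (ℤ.*-zeroʳ e) ⟨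
  c * coeff p 0 + e * 0ℤ                   ∎
  where open ≡-Reasoning
coeff₂-mulLinear c e p (suc (suc k)) = coeff-mulLinear c e p k

record Leading (p : Poly) (d : ℕ) (c : ℤ) : Set where
  field
    top   : coeff p d ≡ c
    above : ∀ k → d ℕ.< k → coeff p k ≡ 0ℤ
open Leading

Leading-≡ : ∀ {p d d′ c c′} → d ≡ d′ → c ≡ c′ → Leading p d c → Leading p d′ c′
Leading-≡ refl refl lead = lead

Leading-shift : ∀ {p d c} → Leading p d c → Leading (0ℤ ∷ p) (suc d) c
Leading-shift lead .top                  = lead .top
Leading-shift lead .above (suc k) (s≤s d<k) = lead .above k d<k

Leading-sumPoly : ∀ {n d} {f : Fin n → Poly} {c : Fin n → ℤ} →
  (∀ j → Leading (f j) d (c j)) → Leading (sumPoly f) d (sumFin c)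
Leading-sumPoly {f = f} lead .top       = trans (coeff-sumPoly f _) (sumFin-cong (λ j → lead j .top))
Leading-sumPoly {f = f} lead .above k d<k = trans (coeff-sumPoly f k) (sumFin-≡0 (λ j → lead j .above k d<k))

Leading-scale : ∀ a {p d c} → Leading p d c → Leading (scale a p) d (a * c)
Leading-scale a {p} lead .top         = trans (coeff-scale a p _) (cong (a *_) (lead .top))
Leading-scale a {p} lead .above k d<k =
  trans (coeff-scale a p k) (trans (cong (a *_) (lead .above k d<k)) (ℤ.*-zeroʳ a))

Leading-mulLinear : ∀ c e {p d a} → Leading p d a → Leading (mulLinear (c , e) p) (suc d) (e * a)
Leading-mulLinear c e {p} {d} {a} lead .top = begin
  coeff (mulLinear (c , e) p) (suc d)
    ≡⟨ coeff-mulLinear c e p d ⟩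
  c * coeff p (suc d) + e * coeff p d
    ≡⟨ cong₂ (λ u v → c * u + e * v) (lead .above (suc d) ℕ.≤-refl) (lead .top) ⟩
  c * 0ℤ + e * a
    ≡⟨ solve (c ∷ e ∷ a ∷ []) ⟩
  e * a ∎
  where open ≡-Reasoning
Leading-mulLinear c e {p} {d} lead .above (suc k) (s≤s d<k) = begin
  coeff (mulLinear (c , e) p) (suc k)
    ≡⟨ coeff-mulLinear c e p k ⟩
  c * coeff p (suc k) + e * coeff p k
    ≡⟨ cong₂ (λ u v → c * u + e * v) (lead .above (suc k) (ℕ.m<n⇒m<1+n d<k)) (lead .above k d<k) ⟩
  c * 0ℤ + e * 0ℤ
    ≡⟨ solve (c ∷ e ∷ []) ⟩
  0ℤ ∎
  where open ≡-Reasoning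

Leading-mulConstant : ∀ c {p d a} → Leading p d a → Leading (mulLinear (c , 0ℤ) p) d (c * a)
Leading-mulConstant c {p} lead .top     = trans (coeff-mulConstant c p _) (cong (c *_) (lead .top))
Leading-mulConstant c {p} lead .above k d<k =
  trans (coeff-mulConstant c p k) (trans (cong (c *_) (lead .above k d<k)) (ℤ.*-zeroʳ c))

-- Determinants of matrices with linear entries

δ-refl : ∀ {n} (i : Fin n) → δ i i ≡ 1ℤ
δ-refl i with i ≟ i
... | yes _  = refl
... | no i≢i = ⊥-elim (i≢i refl)

δ-≢ : ∀ {n} {i j : Fin n} → i ≢ j → δ i j ≡ 0ℤ
δ-≢ {i = i} {j} i≢j with i ≟ j
... | yes i≡j = ⊥-elim (i≢j i≡j)
... | no _    = refl

δ-suc : ∀ {n} (i j : Fin n) → δ (suc i) (suc j) ≡ δ i j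
δ-suc i j with i ≟ j
... | yes refl = refl
... | no _     = refl

δ-sym : ∀ {n} (i j : Fin n) → δ i j ≡ δ j i
δ-sym i j with i ≟ j
... | yes refl = sym (δ-refl i)
... | no i≢j   = sym (δ-≢ (i≢j ∘ sym))

minor : ∀ {A : Set} {n} → Fin (suc n) → (Fin (suc n) → Fin (suc n) → A) → Fin n → Fin n → A
minor j N i k = N (suc i) (punchIn j k)

det-cong : ∀ {n} {M N : Mat n} → (∀ i j → M i j ≡ N i j) → det M ≡ det N
det-cong {zero}  M≗N = refl
det-cong {suc n} M≗N = sumFin-cong λ j →
  cong₂ (λ u v → sgn (toℕ j) * (u * v)) (M≗N zero j) (det-cong (λ i k → M≗N (suc i) (punchIn j k)))

*-zeroˡʳ : ∀ a b → a * (0ℤ * b) ≡ 0ℤ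
*-zeroˡʳ a b = trans (cong (a *_) (ℤ.*-zeroˡ b)) (ℤ.*-zeroʳ a)

*-zeroʳʳ : ∀ a b → a * (b * 0ℤ) ≡ 0ℤ
*-zeroʳʳ a b = trans (cong (a *_) (ℤ.*-zeroʳ b)) (ℤ.*-zeroʳ a)

det-identity : ∀ {n} → det {n} δ ≡ 1ℤ
det-identity {zero}  = refl
det-identity {suc n} = cong₂ _+_
  (cong (λ z → 1ℤ * (1ℤ * z)) (trans (det-cong {n} δ-suc) (det-identity {n})))
  (sumFin-≡0 (λ c → *-zeroˡʳ (sgn (toℕ (suc c))) (det (minor (suc c) (δ {suc n})))))

det-zeroColumn : ∀ {n} (M : Mat (suc n)) → (∀ i → M i zero ≡ 0ℤ) → det M ≡ 0ℤ
det-zeroColumn {zero}  M col≡0 = cong (λ z → 1ℤ * (z * 1ℤ) + 0ℤ) (col≡0 zero)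
det-zeroColumn {suc n} M col≡0 = cong₂ _+_
  (trans (cong (λ z → 1ℤ * (z * det (minor zero M))) (col≡0 zero)) (*-zeroˡʳ 1ℤ (det (minor zero M))))
  (sumFin-≡0 λ c → trans
    (cong (λ z → sgn (toℕ (suc c)) * (M zero (suc c) * z)) (det-zeroColumn (minor (suc c) M) (col≡0 ∘ suc)))
    (*-zeroʳʳ (sgn (toℕ (suc c))) (M zero (suc c))))

-- Rows 1, …, n of the identity matrix of size 1 + n with column 1 + j deleted, and row j replaced by v.
identityMinorWithRow : ∀ {n} → Fin n → (Fin n → ℤ) → Mat n
identityMinorWithRow j v i k = if does (i ≟ j) then v k else δ (suc i) (punchIn (suc j) k)

det-identityMinorWithRow : ∀ {n} (j : Fin (suc n)) (v : Fin (suc n) → ℤ) →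
  det (identityMinorWithRow j v) ≡ sgn (toℕ j) * v zero
det-identityMinorWithRow {zero} zero v = trans (ℤ.+-identityʳ _) (cong (1ℤ *_) (ℤ.*-identityʳ (v zero)))
det-identityMinorWithRow {suc n} zero v = begin
  1ℤ * (v zero * det (minor zero K)) + sumFin (λ c → sgn (toℕ (suc c)) * (v (suc c) * det (minor (suc c) K)))
    ≡⟨ cong₂ _+_ (cong (λ z → 1ℤ * (v zero * z)) (trans (det-cong rest≗identity) (det-identity {suc n})))
                 (sumFin-≡0 λ c → trans
                   (cong (λ z → sgn (toℕ (suc c)) * (v (suc c) * z)) (det-zeroColumn (minor (suc c) K) (λ i → refl)))
                   (*-zeroʳʳ (sgn (toℕ (suc c))) (v (suc c)))) ⟩
  1ℤ * (v zero * 1ℤ) + 0ℤ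
    ≡⟨ trans (ℤ.+-identityʳ _) (cong (1ℤ *_) (ℤ.*-identityʳ (v zero))) ⟩
  1ℤ * v zero ∎
  where
  open ≡-Reasoning
  K = identityMinorWithRow zero v
  rest≗identity : ∀ i k → minor zero K i k ≡ δ i k
  rest≗identity i k = trans (δ-suc (suc i) (suc k)) (δ-suc i k)
det-identityMinorWithRow {suc n} (suc j) v = begin
  1ℤ * (0ℤ * det (minor zero K))
    + (- 1ℤ * (1ℤ * det (minor (suc zero) K))
       + sumFin (λ c → sgn (toℕ (suc (suc c))) * (0ℤ * det (minor (suc (suc c)) K))))
    ≡⟨ cong₂ _+_ (*-zeroˡʳ 1ℤ (det (minor zero K))) (cong₂ _+_
         (cong (λ z → - 1ℤ * (1ℤ * z))
               (trans (det-cong minor₁≗) (det-identityMinorWithRow j (v ∘ punchIn (suc zero)))))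
         (sumFin-≡0 (λ c → *-zeroˡʳ (sgn (toℕ (suc (suc c)))) (det (minor (suc (suc c)) K))))) ⟩
  0ℤ + (- 1ℤ * (1ℤ * (sgn (toℕ j) * v zero)) + 0ℤ)
    ≡⟨ algebra (sgn (toℕ j)) (v zero) ⟩
  - sgn (toℕ j) * v zero ∎
  where
  open ≡-Reasoning
  algebra : ∀ s a → 0ℤ + (- 1ℤ * (1ℤ * (s * a)) + 0ℤ) ≡ - s * a
  algebra = solve-∀
  K = identityMinorWithRow (suc j) v
  minor₁≗ : ∀ i k → minor (suc zero) K i k ≡ identityMinorWithRow j (v ∘ punchIn (suc zero)) i k
  minor₁≗ i k with i ≟ j
  ... | yes _ = refl
  minor₁≗ i zero    | no _ = refl
  minor₁≗ i (suc k) | no _ = δ-suc (suc i) (suc (punchIn j k))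

sgn*sgn : ∀ k → sgn k * sgn k ≡ 1ℤ
sgn*sgn zero    = refl
sgn*sgn (suc k) = trans (algebra (sgn k)) (sgn*sgn k)
  where
  algebra : ∀ s → - s * - s ≡ s * s
  algebra = solve-∀

-- The pair (c , e) stands for the entry c + e t.
LinMat : ℕ → Set
LinMat n = Fin n → Fin n → ℤ × ℤ

detPoly : ∀ {n} → LinMat n → Poly
detPoly {zero}  N = 1ℤ ∷ []
detPoly {suc n} N = sumPoly (λ j → scale (sgn (toℕ j)) (mulLinear (N zero j) (detPoly (minor j N))))

detPoly-cong : ∀ {n} {M N : LinMat n} → (∀ i j → M i j ≡ N i j) → detPoly M ≡ detPoly N
detPoly-cong {zero}  M≗N = refl
detPoly-cong {suc n} M≗N = sumPoly-cong λ j → cong₂ (λ u v → scale (sgn (toℕ j)) (mulLinear u v))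
  (M≗N zero j) (detPoly-cong (λ i k → M≗N (suc i) (punchIn j k)))

evalMat : ∀ {n} → ℤ → LinMat n → Mat n
evalMat t N i j = proj₁ (N i j) + t * proj₂ (N i j)

eval-detPoly : ∀ {n} (N : LinMat n) t → eval (detPoly N) t ≡ det (evalMat t N)
eval-detPoly {zero}  N t = cong (1ℤ +_) (ℤ.*-zeroʳ t)
eval-detPoly {suc n} N t = trans (eval-sumPoly term t) (sumFin-cong λ j → begin
  eval (scale (sgn (toℕ j)) (mulLinear (N zero j) (detPoly (minor j N)))) t
    ≡⟨ eval-scale (sgn (toℕ j)) (mulLinear (N zero j) (detPoly (minor j N))) t ⟩
  sgn (toℕ j) * eval (mulLinear (N zero j) (detPoly (minor j N))) t
    ≡⟨ cong (sgn (toℕ j) *_) (eval-mulLinear (proj₁ (N zero j)) (proj₂ (N zero j)) (detPoly (minor j N)) t) ⟩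
  sgn (toℕ j) * (evalMat t N zero j * eval (detPoly (minor j N)) t)
    ≡⟨ cong (λ z → sgn (toℕ j) * (evalMat t N zero j * z)) (eval-detPoly (minor j N) t) ⟩
  sgn (toℕ j) * (evalMat t N zero j * det (minor j (evalMat t N))) ∎)
  where
  open ≡-Reasoning
  term : Fin (suc n) → Poly
  term j = scale (sgn (toℕ j)) (mulLinear (N zero j) (detPoly (minor j N)))

countTrue : ∀ {n} → (Fin n → Bool) → ℕ
countTrue {zero}  d = 0
countTrue {suc n} d = (if d zero then 1 else 0) ℕ.+ countTrue (d ∘ suc)

countTrue-const : ∀ n → countTrue {n} (λ _ → true) ≡ n
countTrue-const zero    = refl
countTrue-const (suc n) = cong suc (countTrue-const n)

leadingMat : ∀ {n} → (Fin n → Bool) → LinMat n → Mat n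
leadingMat d N i j = if d i then proj₂ (N i j) else proj₁ (N i j)

ConstantOutside : ∀ {n} → (Fin n → Bool) → LinMat n → Set
ConstantOutside d N = ∀ i j → d i ≡ false → proj₂ (N i j) ≡ 0ℤ

Leading-mulEntry : ∀ b c e {p d a} → (b ≡ false → e ≡ 0ℤ) → Leading p d a →
  Leading (mulLinear (c , e) p) ((if b then 1 else 0) ℕ.+ d) ((if b then e else c) * a)
Leading-mulEntry true  c e e≡0 lead = Leading-mulLinear c e lead
Leading-mulEntry false c e e≡0 lead with refl ← e≡0 refl = Leading-mulConstant c lead

detPoly-Leading : ∀ {n} (d : Fin n → Bool) (N : LinMat n) → ConstantOutside d N →
  Leading (detPoly N) (countTrue d) (det (leadingMat d N))
detPoly-Leading {zero}  d N const = record { top = refl ; above = λ { (suc k) _ → refl } }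
detPoly-Leading {suc n} d N const = Leading-sumPoly λ j → Leading-scale (sgn (toℕ j))
  (Leading-mulEntry (d zero) (proj₁ (N zero j)) (proj₂ (N zero j)) (const zero j)
    (detPoly-Leading (d ∘ suc) (minor j N) (λ i k → const (suc i) (punchIn j k))))

-- The top coefficients of the characteristic polynomial

charMat : ∀ {n} → Mat n → LinMat n
charMat M i j = (- M i j , δ i j)

charPolynomial : ∀ {n} → Mat n → Poly
charPolynomial M = detPoly (charMat M)

eval-charPolynomial : ∀ {n} (M : Mat n) t → eval (charPolynomial M) t ≡ charPoly M t
eval-charPolynomial M t = trans (eval-detPoly (charMat M) t) (det-cong (λ i j → algebra (M i j) t (δ i j)))
  where
  algebra : ∀ a t d → - a + t * d ≡ t * d - a
  algebra = solve-∀

cospectral⇒coeff₂≡ : ∀ {n} (A B : Mat n) → Cospectral A B →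
  ∀ k → coeff₂ (charPolynomial A) k ≡ coeff₂ (charPolynomial B) k
cospectral⇒coeff₂≡ A B A~B zero          = refl
cospectral⇒coeff₂≡ A B A~B (suc zero)    = refl
cospectral⇒coeff₂≡ A B A~B (suc (suc k)) = eval≗⇒coeff≡ (charPolynomial A) (charPolynomial B)
  (λ m → trans (eval-charPolynomial A +[1+ m ]) (trans (A~B +[1+ m ]) (sym (eval-charPolynomial B +[1+ m ])))) k

trace : ∀ {n} → Mat n → ℤ
trace M = sumFin (λ i → M i i)

crossTerm : ∀ {n} → Mat (suc n) → ℤ
crossTerm M = sumFin (λ j → M zero (suc j) * M (suc j) zero)

-- the sum of the principal 2 × 2 minors, by expansion along the first row and column
σ₂ : ∀ {n} → Mat n → ℤ
σ₂ {zero}  M = 0ℤ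
σ₂ {suc n} M = M zero zero * trace (minor zero M) + σ₂ (minor zero M) - crossTerm M

allBut : ∀ {n} → Fin n → Fin n → Bool
allBut j i = not (does (i ≟ j))

countTrue-allBut : ∀ {n} (j : Fin (suc n)) → countTrue (allBut j) ≡ n
countTrue-allBut {n}     zero    = countTrue-const n
countTrue-allBut {suc n} (suc j) = cong suc (countTrue-allBut j)

-- After deleting row 0 and column 1 + j from t I - M, only row j has no t left.
offDiagonalMinor-Leading : ∀ {n} (M : Mat (suc (suc n))) (j : Fin (suc n)) →
  Leading (detPoly (minor (suc j) (charMat M))) n (sgn (toℕ j) * - M (suc j) zero)
offDiagonalMinor-Leading {n} M j = Leading-≡ (countTrue-allBut j)
  (trans (det-cong leading≗) (det-identityMinorWithRow j row))
  (detPoly-Leading (allBut j) N constantRows)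
  where
  N = minor (suc j) (charMat M)
  row : Fin (suc n) → ℤ
  row k = - M (suc j) (punchIn (suc j) k)
  constantRows : ConstantOutside (allBut j) N
  constantRows i k _ with i ≟ j
  constantRows i k () | no _
  ... | yes refl = δ-≢ (λ eq → punchInᵢ≢i (suc j) k (sym eq))
  leading≗ : ∀ i k → leadingMat (allBut j) N i k ≡ identityMinorWithRow j row i k
  leading≗ i k with i ≟ j
  ... | yes refl = refl
  ... | no _     = refl

expansionTerm : ∀ {n} → Mat (suc n) → Fin (suc n) → Poly
expansionTerm M j = scale (sgn (toℕ j)) (mulLinear (charMat M zero j) (detPoly (minor j (charMat M))))

-- The terms 1 + j of the first-row expansion of det (t I - M); the factor t lets n = 0 fit the statement.
offDiagonalTerms-Leading : ∀ {n} (M : Mat (suc n)) →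
  Leading (0ℤ ∷ sumPoly (expansionTerm M ∘ suc)) n (- crossTerm M)
offDiagonalTerms-Leading {zero}  M = record { top = refl ; above = λ { (suc k) _ → refl } }
offDiagonalTerms-Leading {suc n} M = Leading-shift (Leading-≡ refl value
  (Leading-sumPoly λ j → Leading-scale (sgn (toℕ (suc j)))
    (Leading-mulConstant (- M zero (suc j)) (offDiagonalMinor-Leading M j))))
  where
  algebra : ∀ s a b → - s * (- a * (s * - b)) ≡ - ((s * s) * (a * b))
  algebra = solve-∀
  term≡ : ∀ j → - sgn (toℕ j) * (- M zero (suc j) * (sgn (toℕ j) * - M (suc j) zero))
                ≡ - (M zero (suc j) * M (suc j) zero)
  term≡ j = trans (algebra (sgn (toℕ j)) (M zero (suc j)) (M (suc j) zero))
    (trans (cong (λ s → - (s * (M zero (suc j) * M (suc j) zero))) (sgn*sgn (toℕ j))) (cong -_ (ℤ.*-identityˡ _)))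
  value : sumFin (λ j → - sgn (toℕ j) * (- M zero (suc j) * (sgn (toℕ j) * - M (suc j) zero))) ≡ - crossTerm M
  value = trans (sumFin-cong term≡) (sumFin-neg (λ j → M zero (suc j) * M (suc j) zero))

record TopCoefficients {n} (M : Mat n) : Set where
  field
    vanish  : ∀ k → suc (suc n) ℕ.< k → coeff₂ (charPolynomial M) k ≡ 0ℤ
    monic   : coeff₂ (charPolynomial M) (suc (suc n)) ≡ 1ℤ
    traceᶜ  : coeff₂ (charPolynomial M) (suc n) ≡ - trace M
    σ₂ᶜ     : coeff₂ (charPolynomial M) n ≡ σ₂ M

charPolynomial-coeff₂-suc : ∀ {n} (M : Mat (suc n)) k →
  coeff₂ (charPolynomial M) (suc k) ≡
    - M zero zero * coeff₂ (charPolynomial (minor zero M)) (suc k) + coeff₂ (charPolynomial (minor zero M)) k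
    + coeff (0ℤ ∷ sumPoly (expansionTerm M ∘ suc)) k
charPolynomial-coeff₂-suc M k = begin
  coeff₂ (charPolynomial M) (suc k)
    ≡⟨ coeff₂-⊕ (expansionTerm M zero) (sumPoly (expansionTerm M ∘ suc)) (suc k) ⟩
  coeff₂ (scale 1ℤ (mulLinear (- a , 1ℤ) (detPoly (minor zero (charMat M))))) (suc k) + T
    ≡⟨ cong (λ p → coeff₂ (scale 1ℤ (mulLinear (- a , 1ℤ) p)) (suc k) + T) diagonalMinor≡ ⟩
  coeff₂ (scale 1ℤ (mulLinear (- a , 1ℤ) P′)) (suc k) + T
    ≡⟨ cong (_+ T) (trans (coeff₂-scale 1ℤ (mulLinear (- a , 1ℤ) P′) (suc k))
                          (cong (1ℤ *_) (coeff₂-mulLinear (- a) 1ℤ P′ k))) ⟩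
  1ℤ * (- a * coeff₂ P′ (suc k) + 1ℤ * coeff₂ P′ k) + T
    ≡⟨ algebra a (coeff₂ P′ (suc k)) (coeff₂ P′ k) T ⟩
  - a * coeff₂ P′ (suc k) + coeff₂ P′ k + T ∎
  where
  open ≡-Reasoning
  a = M zero zero
  P′ = charPolynomial (minor zero M)
  T = coeff (0ℤ ∷ sumPoly (expansionTerm M ∘ suc)) k
  diagonalMinor≡ : detPoly (minor zero (charMat M)) ≡ P′
  diagonalMinor≡ = detPoly-cong (λ i k → cong (λ x → (- M (suc i) (suc k) , x)) (δ-suc i k))
  algebra : ∀ a x y z → 1ℤ * (- a * x + 1ℤ * y) + z ≡ - a * x + y + z
  algebra = solve-∀

charPolynomial-top : ∀ {n} (M : Mat n) → TopCoefficients M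
charPolynomial-top {zero} M = record
  { vanish = λ { (suc (suc (suc k))) _ → refl ; (suc zero) (s≤s ()) ; (suc (suc zero)) (s≤s (s≤s ())) }
  ; monic = refl ; traceᶜ = refl ; σ₂ᶜ = refl }
charPolynomial-top {suc n} M = record
  { vanish = λ { (suc k) (s≤s 2+n<k) →
      step k (IH.vanish (suc k) (ℕ.m<n⇒m<1+n 2+n<k)) (IH.vanish k 2+n<k)
             (offDiagonal .above k (ℕ.<-trans (ℕ.n<1+n n) (ℕ.<-trans (ℕ.n<1+n (suc n)) 2+n<k))) (vanishes a) }
  ; monic  = step (suc (suc n)) (IH.vanish (suc (suc (suc n))) ℕ.≤-refl) IH.monic
                  (offDiagonal .above (suc (suc n)) (ℕ.m<n⇒m<1+n ℕ.≤-refl)) (leading a)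
  ; traceᶜ = step (suc n) IH.monic IH.traceᶜ (offDiagonal .above (suc n) ℕ.≤-refl) (subleading a (trace M′))
  ; σ₂ᶜ    = step n IH.traceᶜ IH.σ₂ᶜ (offDiagonal .top) (subsubleading a (trace M′) (σ₂ M′) (crossTerm M))
  }
  where
  a = M zero zero
  M′ = minor zero M
  P′ = charPolynomial M′
  module IH = TopCoefficients (charPolynomial-top M′)
  offDiagonal = offDiagonalTerms-Leading M
  step : ∀ k {x y z r} → coeff₂ P′ (suc k) ≡ x → coeff₂ P′ k ≡ y → coeff (0ℤ ∷ sumPoly (expansionTerm M ∘ suc)) k ≡ z →
    - a * x + y + z ≡ r → coeff₂ (charPolynomial M) (suc k) ≡ r
  step k refl refl refl eq = trans (charPolynomial-coeff₂-suc M k) eq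
  vanishes : ∀ a → - a * 0ℤ + 0ℤ + 0ℤ ≡ 0ℤ
  vanishes = solve-∀
  leading : ∀ a → - a * 0ℤ + 1ℤ + 0ℤ ≡ 1ℤ
  leading = solve-∀
  subleading : ∀ a t → - a * 1ℤ + - t + 0ℤ ≡ - (a + t)
  subleading = solve-∀
  subsubleading : ∀ a t s x → - a * - t + s + - x ≡ a * t + s - x
  subsubleading = solve-∀

cospectral⇒trace≡ : ∀ {n} (A B : Mat n) → Cospectral A B → trace A ≡ trace B
cospectral⇒trace≡ {n} A B A~B = ℤ.neg-injective (begin
  - trace A                            ≡⟨ TopCoefficients.traceᶜ (charPolynomial-top A) ⟨
  coeff₂ (charPolynomial A) (suc n)    ≡⟨ cospectral⇒coeff₂≡ A B A~B (suc n) ⟩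
  coeff₂ (charPolynomial B) (suc n)    ≡⟨ TopCoefficients.traceᶜ (charPolynomial-top B) ⟩
  - trace B                            ∎)
  where open ≡-Reasoning

cospectral⇒σ₂≡ : ∀ {n} (A B : Mat n) → Cospectral A B → σ₂ A ≡ σ₂ B
cospectral⇒σ₂≡ {n} A B A~B = begin
  σ₂ A                           ≡⟨ TopCoefficients.σ₂ᶜ (charPolynomial-top A) ⟨
  coeff₂ (charPolynomial A) n    ≡⟨ cospectral⇒coeff₂≡ A B A~B n ⟩
  coeff₂ (charPolynomial B) n    ≡⟨ TopCoefficients.σ₂ᶜ (charPolynomial-top B) ⟩
  σ₂ B                           ∎
  where open ≡-Reasoning

traceOfSquare : ∀ {n} → Mat n → ℤ
traceOfSquare M = sumFin (λ i → sumFin (λ j → M i j * M j i))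

traceOfSquare≡ : ∀ {n} (M : Mat n) → traceOfSquare M ≡ trace M * trace M - (σ₂ M + σ₂ M)
traceOfSquare≡ {zero}  M = refl
traceOfSquare≡ {suc n} M = begin
  a * a + X + sumFin (λ i → M (suc i) zero * M zero (suc i) + sumFin (λ j → M′ i j * M′ j i))
    ≡⟨ cong (a * a + X +_) (sumFin-+ (λ i → M (suc i) zero * M zero (suc i))
                                     (λ i → sumFin (λ j → M′ i j * M′ j i))) ⟩
  a * a + X + (sumFin (λ i → M (suc i) zero * M zero (suc i)) + traceOfSquare M′)
    ≡⟨ cong₂ (λ u v → a * a + X + (u + v)) (sumFin-cong (λ i → ℤ.*-comm (M (suc i) zero) (M zero (suc i))))
                                           (traceOfSquare≡ M′) ⟩
  a * a + X + (X + (trace M′ * trace M′ - (σ₂ M′ + σ₂ M′)))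
    ≡⟨ algebra a X (trace M′) (σ₂ M′) ⟩
  (a + trace M′) * (a + trace M′) - (σ₂ M + σ₂ M) ∎
  where
  open ≡-Reasoning
  a = M zero zero
  M′ = minor zero M
  X = crossTerm M
  algebra : ∀ a x t s → a * a + x + (x + (t * t - (s + s))) ≡ (a + t) * (a + t) - ((a * t + s - x) + (a * t + s - x))
  algebra = solve-∀

cospectral⇒traceOfSquare≡ : ∀ {n} (A B : Mat n) → Cospectral A B → traceOfSquare A ≡ traceOfSquare B
cospectral⇒traceOfSquare≡ A B A~B = begin
  traceOfSquare A
    ≡⟨ traceOfSquare≡ A ⟩
  trace A * trace A - (σ₂ A + σ₂ A)
    ≡⟨ cong₂ (λ t s → t * t - (s + s)) (cospectral⇒trace≡ A B A~B) (cospectral⇒σ₂≡ A B A~B) ⟩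
  trace B * trace B - (σ₂ B + σ₂ B)
    ≡⟨ traceOfSquare≡ B ⟨
  traceOfSquare B ∎
  where open ≡-Reasoning

-- The defect

square-nonNeg : ∀ b → 0ℤ ≤ b * b
square-nonNeg +0       = ℤ.≤-refl
square-nonNeg +[1+ n ] = +≤+ ℕ.z≤n
square-nonNeg -[1+ n ] = +≤+ ℕ.z≤n

consecutive-nonNeg : ∀ b → 0ℤ ≤ b * (b - 1ℤ)
consecutive-nonNeg +0             = ℤ.≤-refl
consecutive-nonNeg +[1+ zero ]    = ℤ.≤-refl
consecutive-nonNeg +[1+ suc n ]   = +≤+ ℕ.z≤n
consecutive-nonNeg -[1+ n ]       = +≤+ ℕ.z≤n

sumFin-nonNeg : ∀ {n} {f : Fin n → ℤ} → (∀ i → 0ℤ ≤ f i) → 0ℤ ≤ sumFin f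
sumFin-nonNeg {zero}  f≥0 = ℤ.≤-refl
sumFin-nonNeg {suc n} f≥0 = ℤ.+-mono-≤ (f≥0 zero) (sumFin-nonNeg (f≥0 ∘ suc))

nonNeg-+≡0 : ∀ {x y} → 0ℤ ≤ x → 0ℤ ≤ y → x + y ≡ 0ℤ → x ≡ 0ℤ × y ≡ 0ℤ
nonNeg-+≡0 {x} (+≤+ _) (+≤+ _) x+y≡0
  with ℕ.m+n≡0⇒m≡0 ∣ x ∣ (cong ∣_∣ x+y≡0) | ℕ.m+n≡0⇒n≡0 ∣ x ∣ (cong ∣_∣ x+y≡0)
... | refl | refl = refl , refl

nonNeg-sumFin≡0 : ∀ {n} {f : Fin n → ℤ} → (∀ i → 0ℤ ≤ f i) → sumFin f ≡ 0ℤ → ∀ i → f i ≡ 0ℤ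
nonNeg-sumFin≡0 f≥0 sum≡0 zero    = proj₁ (nonNeg-+≡0 (f≥0 zero) (sumFin-nonNeg (f≥0 ∘ suc)) sum≡0)
nonNeg-sumFin≡0 f≥0 sum≡0 (suc i) =
  nonNeg-sumFin≡0 (f≥0 ∘ suc) (proj₂ (nonNeg-+≡0 (f≥0 zero) (sumFin-nonNeg (f≥0 ∘ suc)) sum≡0)) i

nonNeg-sumFin²≡0 : ∀ {n} {f : Fin n → Fin n → ℤ} → (∀ i j → 0ℤ ≤ f i j) →
  sumFin (λ i → sumFin (f i)) ≡ 0ℤ → ∀ i j → f i j ≡ 0ℤ
nonNeg-sumFin²≡0 f≥0 sum≡0 i = nonNeg-sumFin≡0 (f≥0 i) (nonNeg-sumFin≡0 (sumFin-nonNeg ∘ f≥0) sum≡0 i)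

defect : ∀ {n} → Mat n → Fin n → Fin n → ℤ
defect M i j = M i j * M j i + compl M i j * compl M j i - (1ℤ - δ i j) * (1ℤ - δ i j)

totalDefect : ∀ {n} → Mat n → ℤ
totalDefect M = sumFin (λ i → sumFin (defect M i))

offDiagonalCount : ℕ → ℤ
offDiagonalCount n = sumFin {n} (λ i → sumFin (λ j → (1ℤ - δ i j) * (1ℤ - δ i j)))

totalDefect≡ : ∀ {n} (M : Mat n) → totalDefect M ≡ traceOfSquare M + traceOfSquare (compl M) - offDiagonalCount n
totalDefect≡ M = trans
  (sumFin-cong λ i → sumFin-+- (λ j → M i j * M j i) (λ j → compl M i j * compl M j i)
                               (λ j → (1ℤ - δ i j) * (1ℤ - δ i j)))
  (sumFin-+- (λ i → sumFin (λ j → M i j * M j i)) (λ i → sumFin (λ j → compl M i j * compl M j i))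
             (λ i → sumFin (λ j → (1ℤ - δ i j) * (1ℤ - δ i j))))

genCospectral⇒totalDefect≡ : ∀ {n} (A B : Mat n) → GenCospectral A B → totalDefect A ≡ totalDefect B
genCospectral⇒totalDefect≡ {n} A B (A~B , Ā~B̄) = begin
  totalDefect A
    ≡⟨ totalDefect≡ A ⟩
  traceOfSquare A + traceOfSquare (compl A) - offDiagonalCount n
    ≡⟨ cong₂ (λ x y → x + y - offDiagonalCount n) (cospectral⇒traceOfSquare≡ A B A~B)
             (cospectral⇒traceOfSquare≡ (compl A) (compl B) Ā~B̄) ⟩
  traceOfSquare B + traceOfSquare (compl B) - offDiagonalCount n
    ≡⟨ totalDefect≡ B ⟨
  totalDefect B ∎
  where open ≡-Reasoning

entryDefect : ℤ → ℤ → ℤ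
entryDefect b d = b * b + (1ℤ - d - b) * (1ℤ - d - b) - (1ℤ - d) * (1ℤ - d)

symmetric⇒defect≡ : ∀ {n} {M : Mat n} → Symmetric M → ∀ i j → defect M i j ≡ entryDefect (M i j) (δ i j)
symmetric⇒defect≡ {M = M} sym-M i j =
  cong₂ (λ b d → M i j * b + (1ℤ - δ i j - M i j) * (1ℤ - d - b) - (1ℤ - δ i j) * (1ℤ - δ i j))
        (sym-M j i) (δ-sym j i)

entryDefect-diagonal : ∀ b → entryDefect b 1ℤ ≡ b * b + b * b
entryDefect-diagonal = algebra
  where
  algebra : ∀ b → b * b + (1ℤ - 1ℤ - b) * (1ℤ - 1ℤ - b) - (1ℤ - 1ℤ) * (1ℤ - 1ℤ) ≡ b * b + b * b
  algebra = solve-∀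

entryDefect-offDiagonal : ∀ b → entryDefect b 0ℤ ≡ b * (b - 1ℤ) + b * (b - 1ℤ)
entryDefect-offDiagonal = algebra
  where
  algebra : ∀ b → b * b + (1ℤ - 0ℤ - b) * (1ℤ - 0ℤ - b) - (1ℤ - 0ℤ) * (1ℤ - 0ℤ)
                ≡ b * (b - 1ℤ) + b * (b - 1ℤ)
  algebra = solve-∀

symmetric⇒defect-diagonal : ∀ {n} {M : Mat n} → Symmetric M → ∀ i → defect M i i ≡ M i i * M i i + M i i * M i i
symmetric⇒defect-diagonal {M = M} sym-M i = begin
  defect M i i                ≡⟨ symmetric⇒defect≡ sym-M i i ⟩
  entryDefect (M i i) (δ i i) ≡⟨ cong (entryDefect (M i i)) (δ-refl i) ⟩
  entryDefect (M i i) 1ℤ      ≡⟨ entryDefect-diagonal (M i i) ⟩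
  M i i * M i i + M i i * M i i ∎
  where open ≡-Reasoning

symmetric⇒defect-offDiagonal : ∀ {n} {M : Mat n} → Symmetric M → ∀ {i j} → i ≢ j →
  defect M i j ≡ M i j * (M i j - 1ℤ) + M i j * (M i j - 1ℤ)
symmetric⇒defect-offDiagonal {M = M} sym-M {i} {j} i≢j = begin
  defect M i j                ≡⟨ symmetric⇒defect≡ sym-M i j ⟩
  entryDefect (M i j) (δ i j) ≡⟨ cong (entryDefect (M i j)) (δ-≢ i≢j) ⟩
  entryDefect (M i j) 0ℤ      ≡⟨ entryDefect-offDiagonal (M i j) ⟩
  M i j * (M i j - 1ℤ) + M i j * (M i j - 1ℤ) ∎
  where open ≡-Reasoning

adjacency⇒defect≡0 : ∀ {n} {A : Mat n} → IsAdjacency A → ∀ i j → defect A i j ≡ 0ℤ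
adjacency⇒defect≡0 {A = A} (sym-A , zeroDiagonal , zeroOne) i j = byCases (i ≟ j) (zeroOne i j)
  where
  byCases : Dec (i ≡ j) → A i j ≡ 0ℤ ⊎ A i j ≡ 1ℤ → defect A i j ≡ 0ℤ
  byCases (yes refl) _           = trans (symmetric⇒defect≡ sym-A i i) (cong₂ entryDefect (zeroDiagonal i) (δ-refl i))
  byCases (no i≢j)   (inj₁ Aij≡0) = trans (symmetric⇒defect≡ sym-A i j) (cong₂ entryDefect Aij≡0 (δ-≢ i≢j))
  byCases (no i≢j)   (inj₂ Aij≡1) = trans (symmetric⇒defect≡ sym-A i j) (cong₂ entryDefect Aij≡1 (δ-≢ i≢j))

symmetric⇒defect-nonNeg : ∀ {n} {M : Mat n} → Symmetric M → ∀ i j → 0ℤ ≤ defect M i j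
symmetric⇒defect-nonNeg {M = M} sym-M i j = byCases (i ≟ j)
  where
  byCases : Dec (i ≡ j) → 0ℤ ≤ defect M i j
  byCases (yes refl) = subst (0ℤ ≤_) (sym (symmetric⇒defect-diagonal sym-M i))
    (ℤ.+-mono-≤ (square-nonNeg (M i i)) (square-nonNeg (M i i)))
  byCases (no i≢j)   = subst (0ℤ ≤_) (sym (symmetric⇒defect-offDiagonal sym-M i≢j))
    (ℤ.+-mono-≤ (consecutive-nonNeg (M i j)) (consecutive-nonNeg (M i j)))

defect≡0⇒diagonal≡0 : ∀ {n} {M : Mat n} → Symmetric M → ∀ i → defect M i i ≡ 0ℤ → M i i ≡ 0ℤ
defect≡0⇒diagonal≡0 {M = M} sym-M i defect≡0 = [ id , id ]′ (ℤ.i*j≡0⇒i≡0∨j≡0 (M i i)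
  (proj₁ (nonNeg-+≡0 (square-nonNeg (M i i)) (square-nonNeg (M i i))
    (trans (sym (symmetric⇒defect-diagonal sym-M i)) defect≡0))))

defect≡0⇒zeroOne : ∀ {n} {M : Mat n} → Symmetric M → ∀ {i j} → i ≢ j → defect M i j ≡ 0ℤ →
  M i j ≡ 0ℤ ⊎ M i j ≡ 1ℤ
defect≡0⇒zeroOne {M = M} sym-M {i} {j} i≢j defect≡0 = Sum.map₂ (ℤ.i-j≡0⇒i≡j (M i j) 1ℤ)
  (ℤ.i*j≡0⇒i≡0∨j≡0 (M i j) (proj₁ (nonNeg-+≡0 (consecutive-nonNeg (M i j)) (consecutive-nonNeg (M i j))
    (trans (sym (symmetric⇒defect-offDiagonal sym-M i≢j)) defect≡0))))

lemma2p17 : (n : ℕ) (A B : Mat n) → IsAdjacency A → Symmetric B →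
    GenCospectral A B → IsAdjacency B
lemma2p17 n A B adjacency-A sym-B A≈B = sym-B , zeroDiagonal , zeroOne
  where
  totalDefect-B≡0 : totalDefect B ≡ 0ℤ
  totalDefect-B≡0 = trans (sym (genCospectral⇒totalDefect≡ A B A≈B))
    (sumFin-≡0 λ i → sumFin-≡0 (adjacency⇒defect≡0 adjacency-A i))
  defect-B≡0 : ∀ i j → defect B i j ≡ 0ℤ
  defect-B≡0 = nonNeg-sumFin²≡0 (symmetric⇒defect-nonNeg sym-B) totalDefect-B≡0
  zeroDiagonal : ∀ i → B i i ≡ 0ℤ
  zeroDiagonal i = defect≡0⇒diagonal≡0 sym-B i (defect-B≡0 i i)
  zeroOne : ∀ i j → B i j ≡ 0ℤ ⊎ B i j ≡ 1ℤ
  zeroOne i j with i ≟ j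
  ... | yes refl = inj₁ (zeroDiagonal i)
  ... | no i≢j   = defect≡0⇒zeroOne sym-B i≢j (defect-B≡0 i j)
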